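{- Let $A,B\subseteq[n]$ with $|A|=|B|=s\ge2$. If $(a,b)\in N(A,B)$, then $N(A\setminus\{a\},B\setminus\{b\})\subseteq N(A,B)$.
   Context: For $s\ge1$ and $A=\{a_1<\dots<a_s\}$, $B=\{b_1<\dots<b_s\}\subseteq[n]$, let $\ell$ be the least integer $0\le\ell\le s$ such that $a_{i+\ell}>b_i$ for all $1\le i\le s-\ell$. Then $N(A,B)=\{(a_{(i+\ell)\bmod s},b_i):i=1,\dots,s\}$, where $\bmod s$ takes values in $\{1,\dots,s\}$. -}

module Defs where

open import Data.Nat using (ℕ; zero; suc; _+_; _∸_; _≤_; _<_; _≤ᵇ_)
open import Data.Bool using (if_then_else_)
open import Data.List using (List; []; _∷_; length; filter)
open import Data.List.Relation.Unary.All using (All)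
open import Data.List.Relation.Unary.Linked using (Linked)
open import Data.Product using (Σ; _×_; ∃-syntax)
open import Relation.Nullary using (¬_; ¬?)
open import Relation.Binary.PropositionalEquality using (_≡_)
open import Data.Nat using (_≟_)

-- A subset {a₁ < … < a_s} of [n] = {1,…,n} is represented by the strictly
-- increasing list of its elements, each in [1,n].
IsSubsetOf[n] : ℕ → List ℕ → Set
IsSubsetOf[n] n A = Linked _<_ A × All (λ x → 1 ≤ x × x ≤ n) A

-- 1-indexed access: at A i = a_i (for 1 ≤ i ≤ |A|; junk value 0 otherwise).
at : List ℕ → ℕ → ℕ
at []       _             = 0
at (x ∷ xs) zero          = 0
at (x ∷ xs) (suc zero)    = x
at (x ∷ xs) (suc (suc k)) = at xs (suc k)

-- k mod s taking values in {1,…,s}; only used for 1 ≤ k ≤ 2s, where it is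
-- k if k ≤ s and k - s otherwise.
wrap : ℕ → ℕ → ℕ
wrap s k = if k ≤ᵇ s then k else k ∸ s

remove : ℕ → List ℕ → List ℕ
remove a A = filter (λ x → ¬? (x ≟ a)) A

ShiftOk : List ℕ → List ℕ → ℕ → Set
ShiftOk A B ℓ = ∀ i → 1 ≤ i → i + ℓ ≤ length A → at B i < at A (i + ℓ)

IsShift : List ℕ → List ℕ → ℕ → Set
IsShift A B ℓ = ℓ ≤ length A × ShiftOk A B ℓ × (∀ ℓ' → ℓ' < ℓ → ¬ ShiftOk A B ℓ')

InN : List ℕ → List ℕ → ℕ → ℕ → Set
InN A B x y =
  ∃[ ℓ ] (IsShift A B ℓ ×
    ∃[ i ] (1 ≤ i × i ≤ length A × x ≡ at A (wrap (length A) (i + ℓ)) × y ≡ at B i))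

-- Let (a_k, b_j) ∈ N(A,B) come from the shift ℓ, so k ≡ j + ℓ (mod s).  Deleting a_k and
-- b_j leaves lists whose least shift is ℓ' = ℓ if j + ℓ ≤ s and ℓ' = ℓ - 1 otherwise:
-- each condition b'_i < a'_{i+ℓ'} of the shorter lists is one of the conditions at shift ℓ,
-- and by monotonicity a shift t < ℓ' admissible for the shorter lists would make t or t + 1
-- admissible for the original ones, contradicting minimality of ℓ.  Reading positions of
-- the shorter lists as positions of the original ones (skipping j resp. k), the matching
-- i ↦ i + ℓ' mod (s - 1) becomes i ↦ i + ℓ mod s, so the new pairs are old pairs.
module Submission where

open import Defs
open import Data.Nat using (ℕ; zero; suc; pred; _+_; _≤_; _<_; _≤ᵇ_; _≤?_; _<?_; z≤n; s≤s)
open import Data.Nat.Properties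
open import Data.Bool using (true; false)
open import Data.List using (List; []; _∷_; length)
open import Data.List.Properties using (filter-accept; filter-reject; filter-all)
open import Data.List.Membership.Propositional using (_∈_)
open import Data.List.Relation.Unary.All as All using (All)
open import Data.List.Relation.Unary.Any using (here; there)
open import Data.List.Relation.Unary.AllPairs using (AllPairs; []; _∷_)
open import Data.List.Relation.Unary.Linked.Properties using (Linked⇒AllPairs)
open import Data.Product using (_×_; _,_; proj₁; proj₂; ∃-syntax)
open import Data.Sum using (_⊎_; inj₁; inj₂)
open import Function using (_∘_)
open import Relation.Nullary using (¬_; ¬?; yes; no; contradiction)
open import Relation.Nullary.Reflects using (ofʸ; ofⁿ)
open import Relation.Binary.Definitions using (tri<; tri≈; tri>)
open import Relation.Binary.PropositionalEquality

skip : ℕ → ℕ → ℕ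
skip zero    m       = suc m
skip (suc k) zero    = zero
skip (suc k) (suc m) = suc (skip k m)

skip-< : ∀ {k m} → m < k → skip k m ≡ m
skip-< {suc k} {zero}  _         = refl
skip-< {suc k} {suc m} (s≤s m<k) = cong suc (skip-< m<k)

skip-≥ : ∀ {k m} → k ≤ m → skip k m ≡ suc m
skip-≥ {zero}  {m}     _         = refl
skip-≥ {suc k} {suc m} (s≤s k≤m) = cong suc (skip-≥ k≤m)

m≤skip : ∀ k m → m ≤ skip k m
m≤skip zero    m       = n≤1+n m
m≤skip (suc k) zero    = z≤n
m≤skip (suc k) (suc m) = s≤s (m≤skip k m)

skip≤suc : ∀ k m → skip k m ≤ suc m
skip≤suc zero    m       = ≤-refl
skip≤suc (suc k) zero    = z≤n
skip≤suc (suc k) (suc m) = s≤s (skip≤suc k m)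

skip-+ˡ : ∀ ℓ j i → skip (ℓ + j) (ℓ + i) ≡ ℓ + skip j i
skip-+ˡ zero    j i = refl
skip-+ˡ (suc ℓ) j i = cong suc (skip-+ˡ ℓ j i)

skip-+ʳ : ∀ ℓ j i → skip (j + ℓ) (i + ℓ) ≡ skip j i + ℓ
skip-+ʳ ℓ j i rewrite +-comm j ℓ | +-comm i ℓ | +-comm (skip j i) ℓ = skip-+ˡ ℓ j i

wrap-≤ : ∀ {s m} → m ≤ s → wrap s m ≡ m
wrap-≤ {s} {m} m≤s with m ≤ᵇ s | ≤ᵇ-reflects-≤ m s
... | true  | ofʸ _   = refl
... | false | ofⁿ m≰s = contradiction m≤s m≰s

wrap-+ : ∀ s {r} → 1 ≤ r → wrap s (s + r) ≡ r
wrap-+ s {r} 1≤r with s + r ≤ᵇ s | ≤ᵇ-reflects-≤ (s + r) s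
... | true  | ofʸ s+r≤s = contradiction s+r≤s (<⇒≱ (m<m+n s 1≤r))
... | false | ofⁿ _     = m+n∸m≡n s r

m<n⇒∃[o]n≡m+suc[o] : ∀ {m n} → m < n → ∃[ o ] n ≡ m + suc o
m<n⇒∃[o]n≡m+suc[o] {m} m<n with m≤n⇒∃[o]m+o≡n m<n
... | o , refl = o , sym (+-suc m o)

-- The index arithmetic of deleting b_j and a_k, k = (j + ℓ) mod s, from lists of length
-- s = suc s' with shift ℓ, when the shorter lists get shift ℓ'.  An admissible shift
-- t < ℓ' of the shorter lists is transported to t (first case) or to t + 1 (second case).
record Realignment (s' j ℓ k ℓ' : ℕ) : Set where
  field
    1≤j     : 1 ≤ j
    1≤k     : 1 ≤ k
    k≤s     : k ≤ suc s'
    ℓ'≤s'   : ℓ' ≤ s'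
    aligned : ∀ {i} → 1 ≤ i → i + ℓ' ≤ s' → skip j i + ℓ ≡ skip k (i + ℓ')
    aligned-overflow : ∀ {i d} → i ≤ s' → i + ℓ' ≡ s' + suc d →
                       skip j i + ℓ ≡ suc s' + skip k (suc d)
    smaller-shifts : ∀ {t} → t < ℓ' → (j + t < k × t < ℓ) ⊎ suc t < ℓ

  skip-wrap : ∀ {i} → 1 ≤ i → i ≤ s' →
              skip k (wrap s' (i + ℓ')) ≡ wrap (suc s') (skip j i + ℓ)
  skip-wrap {i} 1≤i i≤s' with i + ℓ' ≤? s'
  ... | yes fits = begin
    skip k (wrap s' (i + ℓ'))       ≡⟨ cong (skip k) (wrap-≤ fits) ⟩
    skip k (i + ℓ')                 ≡⟨ wrap-≤ (≤-trans (skip≤suc k (i + ℓ')) (s≤s fits)) ⟨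
    wrap (suc s') (skip k (i + ℓ')) ≡⟨ cong (wrap (suc s')) (aligned 1≤i fits) ⟨
    wrap (suc s') (skip j i + ℓ)    ∎
    where open ≡-Reasoning
  ... | no overflows with m<n⇒∃[o]n≡m+suc[o] (≰⇒> overflows)
  ...   | d , eq = begin
    skip k (wrap s' (i + ℓ'))               ≡⟨ cong (skip k ∘ wrap s') eq ⟩
    skip k (wrap s' (s' + suc d))           ≡⟨ cong (skip k) (wrap-+ s' (s≤s z≤n)) ⟩
    skip k (suc d)                          ≡⟨ wrap-+ (suc s') (≤-trans (s≤s z≤n) (m≤skip k (suc d))) ⟨
    wrap (suc s') (suc s' + skip k (suc d)) ≡⟨ cong (wrap (suc s')) (aligned-overflow i≤s' eq) ⟨
    wrap (suc s') (skip j i + ℓ)            ∎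
    where open ≡-Reasoning

unwrapped : ∀ {s' j ℓ} → 1 ≤ j → j + ℓ ≤ suc s' → Realignment s' j ℓ (j + ℓ) ℓ
unwrapped {s'} {j} {ℓ} 1≤j fits = record
  { 1≤j = 1≤j
  ; 1≤k = ≤-trans 1≤j (m≤m+n j ℓ)
  ; k≤s = fits
  ; ℓ'≤s' = ≤-pred (≤-trans (+-monoˡ-≤ ℓ 1≤j) fits)
  ; aligned = λ {i} _ _ → sym (skip-+ʳ ℓ j i)
  ; aligned-overflow = overflow
  ; smaller-shifts = λ t<ℓ → inj₁ (+-monoʳ-< j t<ℓ , t<ℓ)
  }
  where
  overflow : ∀ {i d} → i ≤ s' → i + ℓ ≡ s' + suc d → skip j i + ℓ ≡ suc s' + skip (j + ℓ) (suc d)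
  overflow {i} {d} i≤s' eq = begin
    skip j i + ℓ                  ≡⟨ cong (_+ ℓ) (skip-≥ j≤i) ⟩
    suc (i + ℓ)                   ≡⟨ cong suc eq ⟩
    suc s' + suc d                ≡⟨ cong (suc s' +_) (skip-< d<k) ⟨
    suc s' + skip (j + ℓ) (suc d) ∎
    where
    open ≡-Reasoning
    j≤i : j ≤ i
    j≤i = +-cancelʳ-≤ ℓ j i (≤-trans fits (≤-trans (m<m+n s' (s≤s z≤n)) (≤-reflexive (sym eq))))
    d<k : suc d < j + ℓ
    d<k = ≤-<-trans (+-cancelˡ-≤ s' (suc d) ℓ (≤-trans (≤-reflexive (sym eq)) (+-monoˡ-≤ ℓ i≤s')))
                    (m<n+m ℓ 1≤j)

wrapped : ∀ {s' j ℓ' k} → 1 ≤ j → j ≤ suc s' → ℓ' ≤ s' → 1 ≤ k → j + suc ℓ' ≡ suc s' + k →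
          Realignment s' j (suc ℓ') k ℓ'
wrapped {s'} {j} {ℓ'} {k} 1≤j j≤s ℓ'≤s' 1≤k eq = record
  { 1≤j = 1≤j
  ; 1≤k = 1≤k
  ; k≤s = ≤-trans k≤ℓ (s≤s ℓ'≤s')
  ; ℓ'≤s' = ℓ'≤s'
  ; aligned = aligned
  ; aligned-overflow = overflow
  ; smaller-shifts = λ t<ℓ' → inj₂ (s≤s t<ℓ')
  }
  where
  k≤ℓ : k ≤ suc ℓ'
  k≤ℓ = +-cancelˡ-≤ (suc s') k (suc ℓ') (≤-trans (≤-reflexive (sym eq)) (+-monoˡ-≤ (suc ℓ') j≤s))
  eq′ : j + ℓ' ≡ s' + k
  eq′ = suc-injective (trans (sym (+-suc j ℓ')) eq)
  aligned : ∀ {i} → 1 ≤ i → i + ℓ' ≤ s' → skip j i + suc ℓ' ≡ skip k (i + ℓ')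
  aligned {i} 1≤i fits = begin
    skip j i + suc ℓ' ≡⟨ cong (_+ suc ℓ') (skip-< i<j) ⟩
    i + suc ℓ'        ≡⟨ +-suc i ℓ' ⟩
    suc (i + ℓ')      ≡⟨ skip-≥ k≤i+ℓ' ⟨
    skip k (i + ℓ')   ∎
    where
    open ≡-Reasoning
    i<j : i < j
    i<j = +-cancelʳ-< ℓ' i j (≤-trans (s≤s fits) (≤-trans (m<m+n s' 1≤k) (≤-reflexive (sym eq′))))
    k≤i+ℓ' : k ≤ i + ℓ'
    k≤i+ℓ' = ≤-trans k≤ℓ (+-monoˡ-≤ ℓ' 1≤i)
  overflow : ∀ {i d} → i ≤ s' → i + ℓ' ≡ s' + suc d → skip j i + suc ℓ' ≡ suc s' + skip k (suc d)
  overflow {i} {d} _ eq-i with i <? j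
  ... | yes i<j = begin
    skip j i + suc ℓ'      ≡⟨ cong (_+ suc ℓ') (skip-< i<j) ⟩
    i + suc ℓ'             ≡⟨ +-suc i ℓ' ⟩
    suc (i + ℓ')           ≡⟨ cong suc eq-i ⟩
    suc s' + suc d         ≡⟨ cong (suc s' +_) (skip-< d<k) ⟨
    suc s' + skip k (suc d) ∎
    where
    open ≡-Reasoning
    d<k : suc d < k
    d<k = +-cancelˡ-< s' (suc d) k (subst₂ _<_ eq-i eq′ (+-monoˡ-< ℓ' i<j))
  ... | no i≮j = begin
    skip j i + suc ℓ'       ≡⟨ cong (_+ suc ℓ') (skip-≥ (≮⇒≥ i≮j)) ⟩
    suc (i + suc ℓ')        ≡⟨ cong suc (+-suc i ℓ') ⟩
    suc (suc (i + ℓ'))      ≡⟨ cong (suc ∘ suc) eq-i ⟩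
    suc (suc (s' + suc d))  ≡⟨ cong suc (+-suc s' (suc d)) ⟨
    suc s' + suc (suc d)    ≡⟨ cong (suc s' +_) (skip-≥ k≤d) ⟨
    suc s' + skip k (suc d) ∎
    where
    open ≡-Reasoning
    k≤d : k ≤ suc d
    k≤d = +-cancelˡ-≤ s' k (suc d) (subst₂ _≤_ eq′ eq-i (+-monoˡ-≤ ℓ' (≮⇒≥ i≮j)))

realignment : ∀ {s' j ℓ} → 1 ≤ j → j ≤ suc s' → ℓ ≤ suc s' →
              ∃[ ℓ' ] Realignment s' j ℓ (wrap (suc s') (j + ℓ)) ℓ'
realignment {s'} {j} {ℓ} 1≤j j≤s ℓ≤s with j + ℓ ≤? suc s'
... | yes fits      = ℓ , subst (λ k → Realignment s' j ℓ k ℓ) (sym (wrap-≤ fits)) (unwrapped 1≤j fits)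
... | no overflows = overflowing ℓ overflows ℓ≤s
  where
  overflowing : ∀ ℓ → ¬ j + ℓ ≤ suc s' → ℓ ≤ suc s' → ∃[ ℓ' ] Realignment s' j ℓ (wrap (suc s') (j + ℓ)) ℓ'
  overflowing zero     overflows _ = contradiction (subst (_≤ suc s') (sym (+-identityʳ j)) j≤s) overflows
  overflowing (suc ℓ') overflows ℓ≤s with m<n⇒∃[o]n≡m+suc[o] (≰⇒> overflows)
  ... | d , eq = ℓ' , subst (λ k → Realignment s' j (suc ℓ') k ℓ') (sym wrap≡)
                            (wrapped 1≤j j≤s (≤-pred ℓ≤s) (s≤s z≤n) eq)
    where
    wrap≡ : wrap (suc s') (j + suc ℓ') ≡ suc d
    wrap≡ = trans (cong (wrap (suc s')) eq) (wrap-+ (suc s') (s≤s z≤n))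

-- The notions of Defs for sequences f g : ℕ → ℕ of length s; for instance
-- ShiftOk A B is SeqShiftOk (at A) (at B) (length A) by definition.
SeqShiftOk : (f g : ℕ → ℕ) (s ℓ : ℕ) → Set
SeqShiftOk f g s ℓ = ∀ i → 1 ≤ i → i + ℓ ≤ s → g i < f (i + ℓ)

SeqIsShift : (f g : ℕ → ℕ) (s ℓ : ℕ) → Set
SeqIsShift f g s ℓ = ℓ ≤ s × SeqShiftOk f g s ℓ × (∀ ℓ' → ℓ' < ℓ → ¬ SeqShiftOk f g s ℓ')

SeqInN : (f g : ℕ → ℕ) (s x y : ℕ) → Set
SeqInN f g s x y =
  ∃[ ℓ ] (SeqIsShift f g s ℓ × ∃[ i ] (1 ≤ i × i ≤ s × x ≡ f (wrap s (i + ℓ)) × y ≡ g i))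

SeqShiftOk-resp : ∀ {f f′ g g′ s ℓ} → f ≗ f′ → g ≗ g′ → SeqShiftOk f g s ℓ → SeqShiftOk f′ g′ s ℓ
SeqShiftOk-resp {ℓ = ℓ} f≗ g≗ ok i 1≤i fits = subst₂ _<_ (g≗ i) (f≗ (i + ℓ)) (ok i 1≤i fits)

SeqIsShift-resp : ∀ {f f′ g g′ s ℓ} → f ≗ f′ → g ≗ g′ → SeqIsShift f g s ℓ → SeqIsShift f′ g′ s ℓ
SeqIsShift-resp f≗ g≗ (ℓ≤s , ok , least) =
  ℓ≤s , SeqShiftOk-resp f≗ g≗ ok , λ t t<ℓ ok′ → least t t<ℓ (SeqShiftOk-resp (sym ∘ f≗) (sym ∘ g≗) ok′)

SeqInN-resp : ∀ {f f′ g g′ s s′ x y} → f ≗ f′ → g ≗ g′ → s ≡ s′ → SeqInN f g s x y → SeqInN f′ g′ s′ x y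
SeqInN-resp f≗ g≗ refl (ℓ , shift , i , 1≤i , i≤s , refl , refl) =
  ℓ , SeqIsShift-resp f≗ g≗ shift , i , 1≤i , i≤s , f≗ _ , g≗ i

SeqIsShift-unique : ∀ {f g s ℓ ℓ′} → SeqIsShift f g s ℓ → SeqIsShift f g s ℓ′ → ℓ ≡ ℓ′
SeqIsShift-unique {ℓ = ℓ} {ℓ′} (_ , ok , least) (_ , ok′ , least′) with <-cmp ℓ ℓ′
... | tri< ℓ<ℓ′ _ _ = contradiction ok (least′ ℓ ℓ<ℓ′)
... | tri≈ _ ℓ≡ℓ′ _ = ℓ≡ℓ′
... | tri> _ _ ℓ′<ℓ = contradiction ok′ (least ℓ′ ℓ′<ℓ)

StrictlyIncreasingOn : ℕ → (ℕ → ℕ) → Set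
StrictlyIncreasingOn s f = ∀ {p q} → 1 ≤ p → p < q → q ≤ s → f p < f q

module _ {f g : ℕ → ℕ} {s' : ℕ}
         (f↑ : StrictlyIncreasingOn (suc s') f) (g↑ : StrictlyIncreasingOn (suc s') g) where

  private
    monotone : ∀ {h} → StrictlyIncreasingOn (suc s') h → ∀ {p q} → 1 ≤ p → p ≤ q → q ≤ suc s' → h p ≤ h q
    monotone h↑ 1≤p p≤q q≤s with m≤n⇒m<n∨m≡n p≤q
    ... | inj₁ p<q  = <⇒≤ (h↑ 1≤p p<q q≤s)
    ... | inj₂ refl = ≤-refl

    g≤g∘skip : ∀ j {i} → 1 ≤ i → i ≤ s' → g i ≤ g (skip j i)
    g≤g∘skip j {i} 1≤i i≤s' = monotone g↑ 1≤i (m≤skip j i) (≤-trans (skip≤suc j i) (s≤s i≤s'))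

    f∘skip≤f∘suc : ∀ k {m} → 1 ≤ m → m ≤ s' → f (skip k m) ≤ f (suc m)
    f∘skip≤f∘suc k {m} 1≤m m≤s' = monotone f↑ (≤-trans 1≤m (m≤skip k m)) (skip≤suc k m) (s≤s m≤s')

  ShiftOk-skip⇒ShiftOk-suc : ∀ {k j t} → SeqShiftOk (f ∘ skip k) (g ∘ skip j) s' t →
                             SeqShiftOk f g (suc s') (suc t)
  ShiftOk-skip⇒ShiftOk-suc {k} {j} {t} ok i 1≤i fits = begin-strict
    g i                ≤⟨ g≤g∘skip j 1≤i (≤-trans (m≤m+n i t) i+t≤s') ⟩
    g (skip j i)       <⟨ ok i 1≤i i+t≤s' ⟩
    f (skip k (i + t)) ≤⟨ f∘skip≤f∘suc k (≤-trans 1≤i (m≤m+n i t)) i+t≤s' ⟩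
    f (suc (i + t))    ≡⟨ cong f (+-suc i t) ⟨
    f (i + suc t)      ∎
    where
    open ≤-Reasoning
    i+t≤s' : i + t ≤ s'
    i+t≤s' = ≤-pred (≤-trans (≤-reflexive (sym (+-suc i t))) fits)

  ShiftOk-skip⇒ShiftOk : ∀ {k j t} → 1 ≤ j → j + t < k → k ≤ suc s' →
                         SeqShiftOk (f ∘ skip k) (g ∘ skip j) s' t → SeqShiftOk f g (suc s') t
  ShiftOk-skip⇒ShiftOk {k} {j} {t} 1≤j j+t<k k≤s ok i 1≤i fits with i + t <? k
  ... | yes i+t<k = begin-strict
    g i                ≤⟨ g≤g∘skip j 1≤i (≤-trans (m≤m+n i t) i+t≤s') ⟩
    g (skip j i)       <⟨ ok i 1≤i i+t≤s' ⟩
    f (skip k (i + t)) ≡⟨ cong f (skip-< i+t<k) ⟩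
    f (i + t)          ∎
    where
    open ≤-Reasoning
    i+t≤s' : i + t ≤ s'
    i+t≤s' = ≤-pred (≤-trans i+t<k k≤s)
  ShiftOk-skip⇒ShiftOk {k} {j} {t} 1≤j j+t<k k≤s ok (suc i) _ fits | no i+t≮k = begin-strict
    g (suc i)          ≡⟨ cong g (skip-≥ j≤i) ⟨
    g (skip j i)       <⟨ ok i 1≤i (≤-pred fits) ⟩
    f (skip k (i + t)) ≤⟨ f∘skip≤f∘suc k (≤-trans 1≤i (m≤m+n i t)) (≤-pred fits) ⟩
    f (suc (i + t))    ∎
    where
    open ≤-Reasoning
    j≤i : j ≤ i
    j≤i = ≤-pred (+-cancelʳ-< t j (suc i) (<-≤-trans j+t<k (≮⇒≥ i+t≮k)))
    1≤i : 1 ≤ i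
    1≤i = ≤-trans 1≤j j≤i

  module _ {j ℓ k ℓ'} (R : Realignment s' j ℓ k ℓ') where
    open Realignment R

    ShiftOk⇒ShiftOk-skip : SeqShiftOk f g (suc s') ℓ → SeqShiftOk (f ∘ skip k) (g ∘ skip j) s' ℓ'
    ShiftOk⇒ShiftOk-skip ok i 1≤i fits =
      subst (λ m → g (skip j i) < f m) (aligned 1≤i fits) (ok (skip j i) (≤-trans 1≤i (m≤skip j i)) skip-fits)
      where
      skip-fits : skip j i + ℓ ≤ suc s'
      skip-fits rewrite aligned 1≤i fits = ≤-trans (skip≤suc k (i + ℓ')) (s≤s fits)

    IsShift⇒IsShift-skip : SeqIsShift f g (suc s') ℓ → SeqIsShift (f ∘ skip k) (g ∘ skip j) s' ℓ'
    IsShift⇒IsShift-skip (_ , ok , least) = ℓ'≤s' , ShiftOk⇒ShiftOk-skip ok , not-ok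
      where
      not-ok : ∀ t → t < ℓ' → ¬ SeqShiftOk (f ∘ skip k) (g ∘ skip j) s' t
      not-ok t t<ℓ' ok′ with smaller-shifts t<ℓ'
      ... | inj₁ (j+t<k , t<ℓ) = least t t<ℓ (ShiftOk-skip⇒ShiftOk 1≤j j+t<k k≤s ok′)
      ... | inj₂ t+1<ℓ         = least (suc t) t+1<ℓ (ShiftOk-skip⇒ShiftOk-suc ok′)

    InN-skip⇒InN : SeqIsShift f g (suc s') ℓ →
                   ∀ {x y} → SeqInN (f ∘ skip k) (g ∘ skip j) s' x y → SeqInN f g (suc s') x y
    InN-skip⇒InN shift (ℓ″ , shift″ , i , 1≤i , i≤s' , refl , refl)
      with SeqIsShift-unique {f ∘ skip k} {g ∘ skip j} shift″ (IsShift⇒IsShift-skip shift)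
    ... | refl = ℓ , shift , skip j i , ≤-trans 1≤i (m≤skip j i) , ≤-trans (skip≤suc j i) (s≤s i≤s') ,
                 cong f (skip-wrap 1≤i i≤s') , refl

at-∈ : ∀ {xs m} → 1 ≤ m → m ≤ length xs → at xs m ∈ xs
at-∈ {x ∷ xs} {suc zero}    _ _         = here refl
at-∈ {x ∷ xs} {suc (suc m)} _ (s≤s m<) = there (at-∈ (s≤s z≤n) m<)

at-zero : ∀ xs → at xs 0 ≡ 0
at-zero []      = refl
at-zero (_ ∷ _) = refl

at-increasing : ∀ {xs} → AllPairs _<_ xs → StrictlyIncreasingOn (length xs) (at xs)
at-increasing (x<xs ∷ _) {suc zero}    {suc (suc q)} _ _         (s≤s q≤) = All.lookup x<xs (at-∈ (s≤s z≤n) q≤)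
at-increasing (_ ∷ xs↑)  {suc (suc p)} {suc (suc q)} _ (s≤s p<q) (s≤s q≤) = at-increasing xs↑ (s≤s z≤n) p<q q≤
at-increasing _          {suc zero}    {suc zero}    _ (s≤s ())  _

remove-head : ∀ {x xs} → All (x <_) xs → remove x (x ∷ xs) ≡ xs
remove-head {x} x<xs =
  trans (filter-reject (λ y → ¬? (y ≟ x)) (λ x≢x → x≢x refl)) (filter-all (λ y → ¬? (y ≟ x)) (All.map >⇒≢ x<xs))

remove-later : ∀ {x y xs} → x < y → remove y (x ∷ xs) ≡ x ∷ remove y xs
remove-later {y = y} x<y = filter-accept (λ z → ¬? (z ≟ y)) (<⇒≢ x<y)

at-remove : ∀ {xs k} → AllPairs _<_ xs → 1 ≤ k → k ≤ length xs → at (remove (at xs k) xs) ≗ at xs ∘ skip k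
at-remove {x ∷ xs} {suc zero} (x<xs ∷ _) _ _ m rewrite remove-head x<xs = at-tail m
  where
  at-tail : ∀ m → at xs m ≡ at (x ∷ xs) (skip 1 m)
  at-tail zero    = at-zero xs
  at-tail (suc m) = refl
at-remove {x ∷ xs} {suc (suc k)} (x<xs ∷ xs↑) _ (s≤s k<) m
  rewrite remove-later {xs = xs} (All.lookup x<xs (at-∈ (s≤s z≤n) k<)) = at-cons m
  where
  at-cons : ∀ m → at (x ∷ remove (at xs (suc k)) xs) m ≡ at (x ∷ xs) (skip (suc (suc k)) m)
  at-cons zero          = refl
  at-cons (suc zero)    = refl
  at-cons (suc (suc m)) = at-remove xs↑ (s≤s z≤n) k< (suc m)

length-remove : ∀ {xs k} → AllPairs _<_ xs → 1 ≤ k → k ≤ length xs →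
                length (remove (at xs k) xs) ≡ pred (length xs)
length-remove {x ∷ xs} {suc zero} (x<xs ∷ _) _ _ = cong length (remove-head x<xs)
length-remove {x ∷ xs@(_ ∷ _)} {suc (suc k)} (x<xs ∷ xs↑) _ (s≤s k<) =
  trans (cong length (remove-later (All.lookup x<xs (at-∈ (s≤s z≤n) k<))))
        (cong suc (length-remove xs↑ (s≤s z≤n) k<))

lemma7p4 : (n : ℕ) (A B : List ℕ) → IsSubsetOf[n] n A → IsSubsetOf[n] n B →
    length A ≡ length B → 2 ≤ length A →
    (a b : ℕ) → InN A B a b →
    ∀ x y → InN (remove a A) (remove b B) x y → InN A B x y
lemma7p4 n [] B _ _ _ ()
lemma7p4 n A@(_ ∷ _) B (A-sorted , _) (B-sorted , _) |A|≡|B| _ _ _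
         (ℓ , shift , j , 1≤j , j≤s , refl , refl) x y xy∈N′ =
  InN-skip⇒InN (at-increasing A-pairs) B↑ R shift
    (SeqInN-resp (at-remove A-pairs 1≤k k≤s) (at-remove B-pairs 1≤j (subst (j ≤_) |A|≡|B| j≤s))
                 (length-remove A-pairs 1≤k k≤s) xy∈N′)
  where
  A-pairs = Linked⇒AllPairs <-trans A-sorted
  B-pairs = Linked⇒AllPairs <-trans B-sorted
  B↑ : StrictlyIncreasingOn (length A) (at B)
  B↑ = subst (λ s → StrictlyIncreasingOn s (at B)) (sym |A|≡|B|) (at-increasing B-pairs)
  R = proj₂ (realignment 1≤j j≤s (proj₁ shift))
  open Realignment R using (1≤k; k≤s)
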